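{- Let $G$ be an $r$-regular Lehman graph with $k=1$ and $r\ge 3$, and let $\mathcal{P}$ be a partition of $V(G)$ into blocks each inducing a copy of $K_{r-1,r-1}$. Then $c(G,\mathcal{P})$ is an $r$-regular negative Lehman graph (i.e. a Lehman graph with $k=-1$).
   Context: A bipartite graph $G$ with $n$ black and $n$ white vertices has bipartite adjacency matrix $A$ (rows indexed by black vertices, columns by white vertices, entry $1$ iff adjacent). $G$ is an $r$-regular Lehman graph with parameter $k\in\{ -1,1,2,\ldots\}$ if $G$ is $r$-regular and there is an $n\times n$ $(0,1)$-matrix $B$ with $AB^T=J+kI$, $J$ the all-ones matrix and $I$ the identity; it is negative if $k=-1$. Given such a partition $\mathcal{P}$ (each block has $r-1$ black and $r-1$ white vertices), the compressed graph $c(G,\mathcal{P})$ is the simple bipartite graph with one black vertex $b_X$ and one white vertex $w_X$ for each block $X\in\mathcal{P}$, where $b_X$ is adjacent to $w_Y$ iff $X=Y$ or some black vertex of $X$ is adjacent in $G$ to some white vertex of $Y$. -}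

module Defs where

open import Data.Nat using (ℕ; zero; suc; _+_; _∸_)
open import Data.Integer using (ℤ; +_) renaming (_+_ to _+ℤ_)
open import Data.Bool using (Bool; true; false; _∧_; _∨_; if_then_else_)
open import Data.Fin using (Fin; zero; suc; _≟_)
open import Data.Product using (∃; _×_; _,_)
open import Relation.Nullary using (yes; no)
open import Relation.Nullary.Decidable using (⌊_⌋)
open import Relation.Binary.PropositionalEquality using (_≡_)

count : ∀ {n} → (Fin n → Bool) → ℕ
count {zero}  p = 0
count {suc n} p = (if p zero then 1 else 0) + count (λ i → p (suc i))

anyFin : ∀ {n} → (Fin n → Bool) → Bool
anyFin {zero}  p = false
anyFin {suc n} p = p zero ∨ anyFin (λ i → p (suc i))

-- n × n (0,1)-matrix; rows indexed by black vertices, columns by white vertices.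
-- A bipartite graph with n black and n white vertices is given by its
-- bipartite adjacency matrix.
BipGraph : ℕ → Set
BipGraph n = Fin n → Fin n → Bool

mulT : ∀ {n} → BipGraph n → BipGraph n → Fin n → Fin n → ℕ
mulT A B i j = count (λ l → A i l ∧ B j l)

JkI : ∀ {n} → ℤ → Fin n → Fin n → ℤ
JkI k i j = if ⌊ i ≟ j ⌋ then + 1 +ℤ k else + 1

Regular : ∀ {n} → ℕ → BipGraph n → Set
Regular r A = (∀ b → count (λ w → A b w) ≡ r) × (∀ w → count (λ b → A b w) ≡ r)

Lehman : ∀ {n} → ℕ → ℤ → BipGraph n → Set
Lehman {n} r k A =
  Regular r A × ∃ λ (B : BipGraph n) → ∀ i j → + (mulT A B i j) ≡ JkI k i j

-- A partition of V(G) into m blocks: blkB assigns each black vertex its block,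
-- blkW each white vertex its block.
record K-Partition {n : ℕ} (r : ℕ) (A : BipGraph n) (m : ℕ) : Set where
  field
    blkB : Fin n → Fin m
    blkW : Fin n → Fin m
    sizeB : ∀ X → count (λ b → ⌊ blkB b ≟ X ⌋) ≡ r ∸ 1
    sizeW : ∀ X → count (λ w → ⌊ blkW w ≟ X ⌋) ≡ r ∸ 1
    complete : ∀ b w → blkB b ≡ blkW w → A b w ≡ true

compress : ∀ {n r m} {A : BipGraph n} → K-Partition r A m → BipGraph m
compress {A = A} P X Y =
  ⌊ X ≟ Y ⌋ ∨ anyFin (λ b → anyFin (λ w →
      ⌊ blkB b ≟ X ⌋ ∧ ⌊ blkW w ≟ Y ⌋ ∧ A b w))
  where open K-Partition P

-- Each black vertex b has its r − 1 block-mates among its r neighbours, so it has exactly one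
-- neighbour f(b) outside its block; dually for white vertices, with g = f⁻¹.  Hence b_X is adjacent
-- to w_X and to the blocks of f(b), b ∈ X.
--
-- Besides ABᵀ = J + I we need BᵀA = J + I.  Since A commutes with J, A(BᵀA) = A(J + I), and A is
-- left-cancellable modulo n + 2: y ↦ yA is injective on (ℤ/(n+2))ⁿ because (yA)Bᵀ = y(J + I) and
-- (n + 1)² ≡ 1, hence surjective, which yields a left inverse of A.  All entries of BᵀA and J + I are
-- below n + 2, so they agree.
--
-- So a column w′ of B meets the black part of every block at most once, contains g(w) whenever it
-- misses the black part of w's block, and, for w ≠ w′, avoids g(w) whenever it meets it.  The
-- witness B′ has as row Z the blocks whose black part is missed by column f(b) of B, for some b ∈ Z.
-- Regularity of c(G, P) needs b ↦ block of f(b) to be injective on each block; this uses a column of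
-- B missing a given block, which exists because every row of B has only (n + 1)/r ones.

module Submission where

open import Defs
open import Data.Bool using (Bool; true; false; _∧_; _∨_; not; if_then_else_)
open import Data.Bool.Properties using (∧-conicalˡ; ∧-conicalʳ; ∧-zeroʳ; ∨-zeroʳ) renaming (_≟_ to _≟ᵇ_)
open import Data.Empty using (⊥-elim)
open import Data.Fin using (Fin; zero; suc; _≟_; toℕ; fromℕ<; funToFin; finToFun; combine; punchOut)
open import Data.Fin.Properties
  using (toℕ-injective; toℕ<n; toℕ-fromℕ<; any?; punchOut-injective; injective⇒≤; finToFun-funToFin; funToFin-finToFin)
open import Data.Nat using (ℕ; zero; suc; _+_; _*_; _∸_; _≤_; _<_; _≥_; _^_; _%_; NonZero; z≤n; s≤s; s≤s⁻¹)
open import Data.Nat.Properties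
  using (+-*-semiring; *-commutativeSemigroup; ≤-trans; ≤-reflexive; m≤n+m; n≤1+n; 1+n≰n; +-mono-≤; +-monoˡ-≤;
         +-suc; +-comm; +-identityʳ;
         +-cancelˡ-≡; +-cancelʳ-≤; *-comm; *-assoc; *-suc; *-identityʳ; *-monoʳ-≤; <⇒≱; module ≤-Reasoning)
open import Data.Nat.DivMod using (m%n<n; %-distribˡ-+; %-distribˡ-*; m%n%n≡m%n; %-remove-+ʳ; m<n⇒m%n≡m)
open import Data.Nat.Divisibility using (m∣m*n)
open import Data.Nat.Tactic.RingSolver using (solve-∀)
open import Data.Product using (∃; _×_; _,_; proj₁; proj₂)
open import Data.Sum using (_⊎_; inj₁; inj₂)
open import Function using (case_of_)
open import Relation.Binary.Bundles using (Setoid)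
open import Relation.Binary.PropositionalEquality
open import Relation.Nullary using (yes; no; ¬_)
open import Relation.Nullary.Decidable using (⌊_⌋)

open import Algebra.Properties.CommutativeSemigroup *-commutativeSemigroup using (x∙yz≈y∙xz)
open import Algebra.Properties.Semiring.Sum +-*-semiring
  using (sum; sum-cong-≗; sum-replicate-zero; ∑-comm; ∑-distrib-+; *-distribˡ-sum; *-distribʳ-sum)

private variable n m : ℕ

≟-true⇒≡ : {i j : Fin n} → ⌊ i ≟ j ⌋ ≡ true → i ≡ j
≟-true⇒≡ {i = i} {j} e with i ≟ j
... | yes i≡j = i≡j

≡⇒≟-true : {i j : Fin n} → i ≡ j → ⌊ i ≟ j ⌋ ≡ true
≡⇒≟-true {i = i} {j} i≡j with i ≟ j
... | yes _ = refl
... | no i≢j = ⊥-elim (i≢j i≡j)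

≟-refl : (i : Fin n) → ⌊ i ≟ i ⌋ ≡ true
≟-refl i = ≡⇒≟-true refl

≢⇒≟-false : {i j : Fin n} → i ≢ j → ⌊ i ≟ j ⌋ ≡ false
≢⇒≟-false {i = i} {j} i≢j with i ≟ j
... | yes i≡j = ⊥-elim (i≢j i≡j)
... | no _ = refl

true≢false : ∀ {b} → b ≡ true → b ≢ false
true≢false refl ()

¬true⇒false : ∀ {b} → b ≢ true → b ≡ false
¬true⇒false {false} _ = refl
¬true⇒false {true} b≢true = ⊥-elim (b≢true refl)

¬false⇒true : ∀ {b} → b ≢ false → b ≡ true
¬false⇒true {true} _ = refl
¬false⇒true {false} b≢false = ⊥-elim (b≢false refl)

not-true⇒false : ∀ {b} → not b ≡ true → b ≡ false
not-true⇒false {false} _ = refl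

≡-from-true⇔true : ∀ {a b} → (a ≡ true → b ≡ true) → (b ≡ true → a ≡ true) → a ≡ b
≡-from-true⇔true {false} {false} _ _ = refl
≡-from-true⇔true {false} {true} _ b⇒a = b⇒a refl
≡-from-true⇔true {true} {false} a⇒b _ = sym (a⇒b refl)
≡-from-true⇔true {true} {true} _ _ = refl

∧-≢-true⇒ : ∀ {a} {i j : Fin n} → a ∧ not ⌊ i ≟ j ⌋ ≡ true → a ≡ true × i ≢ j
∧-≢-true⇒ {a = true} {i} {j} e = refl , λ i≡j → true≢false e (cong not (≡⇒≟-true i≡j))

⇒∧-≢-true : ∀ {a} {i j : Fin n} → a ≡ true → i ≢ j → a ∧ not ⌊ i ≟ j ⌋ ≡ true
⇒∧-≢-true refl i≢j = cong not (≢⇒≟-false i≢j)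

indicator : Bool → ℕ
indicator b = if b then 1 else 0

indicator-∧ : ∀ a b → indicator (a ∧ b) ≡ indicator a * indicator b
indicator-∧ false b = refl
indicator-∧ true b = sym (+-identityʳ (indicator b))

δ : Fin n → Fin n → ℕ
δ i j = indicator ⌊ i ≟ j ⌋

δ-sym : (i j : Fin n) → δ i j ≡ δ j i
δ-sym i j with i ≟ j | j ≟ i
... | yes _ | yes _ = refl
... | no _ | no _ = refl
... | yes i≡j | no j≢i = ⊥-elim (j≢i (sym i≡j))
... | no i≢j | yes j≡i = ⊥-elim (i≢j (sym j≡i))

δ-refl : (i : Fin n) → δ i i ≡ 1
δ-refl i = cong indicator (≟-refl i)

δ-≢ : {i j : Fin n} → i ≢ j → δ i j ≡ 0
δ-≢ i≢j = cong indicator (≢⇒≟-false i≢j)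

sum-δ* : (k : Fin n) (g : Fin n → ℕ) → sum (λ i → δ i k * g i) ≡ g k
sum-δ* {suc n} zero g = trans (cong₂ _+_ (+-identityʳ (g zero)) (sum-replicate-zero n)) (+-identityʳ (g zero))
sum-δ* {suc n} (suc k) g =
  trans (sum-cong-≗ (λ i → cong (_* g (suc i)) (δ-suc i k))) (sum-δ* k (λ i → g (suc i)))
  where
  δ-suc : (i j : Fin n) → δ (suc i) (suc j) ≡ δ i j
  δ-suc i j with i ≟ j
  ... | yes _ = refl
  ... | no _ = refl

sum-mono-≤ : {f g : Fin n → ℕ} → (∀ i → f i ≤ g i) → sum f ≤ sum g
sum-mono-≤ {zero} f≤g = z≤n
sum-mono-≤ {suc n} f≤g = +-mono-≤ (f≤g zero) (sum-mono-≤ (λ i → f≤g (suc i)))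

sum-const : (c : ℕ) → sum {n} (λ _ → c) ≡ n * c
sum-const {zero} c = refl
sum-const {suc n} c = cong (c +_) (sum-const {n} c)

sum-*-suc : (g d : Fin n → ℕ) → sum (λ i → g i * suc (d i)) ≡ sum g + sum (λ i → d i * g i)
sum-*-suc g d = trans (sum-cong-≗ (λ i → trans (*-suc (g i) (d i)) (cong (g i +_) (*-comm (g i) (d i)))))
                      (∑-distrib-+ g (λ i → d i * g i))

vecMat-matVec-assoc : (y : Fin n → ℕ) (M : Fin n → Fin m → ℕ) (x : Fin m → ℕ) →
  sum (λ l → sum (λ i → y i * M i l) * x l) ≡ sum (λ i → y i * sum (λ l → M i l * x l))
vecMat-matVec-assoc y M x = begin
  sum (λ l → sum (λ i → y i * M i l) * x l)
    ≡⟨ sum-cong-≗ (λ l → *-distribʳ-sum (x l) (λ i → y i * M i l)) ⟩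
  sum (λ l → sum (λ i → y i * M i l * x l))
    ≡⟨ ∑-comm (λ l i → y i * M i l * x l) ⟩
  sum (λ i → sum (λ l → y i * M i l * x l))
    ≡⟨ sum-cong-≗ (λ i → trans (sum-cong-≗ (λ l → *-assoc (y i) (M i l) (x l)))
                               (sym (*-distribˡ-sum (y i) (λ l → M i l * x l)))) ⟩
  sum (λ i → y i * sum (λ l → M i l * x l)) ∎
  where open ≡-Reasoning

count≡sum : (p : Fin n → Bool) → count p ≡ sum (λ i → indicator (p i))
count≡sum {zero} p = refl
count≡sum {suc n} p = cong (indicator (p zero) +_) (count≡sum (λ i → p (suc i)))

count-∧≡sum-* : (p q : Fin n → Bool) → count (λ i → p i ∧ q i) ≡ sum (λ i → indicator (p i) * indicator (q i))
count-∧≡sum-* p q = trans (count≡sum (λ i → p i ∧ q i)) (sum-cong-≗ (λ i → indicator-∧ (p i) (q i)))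

count-cong : {p q : Fin n → Bool} → (∀ i → p i ≡ q i) → count p ≡ count q
count-cong {p = p} {q} p≗q =
  trans (count≡sum p) (trans (sum-cong-≗ (λ i → cong indicator (p≗q i))) (sym (count≡sum q)))

count≤n : (p : Fin n → Bool) → count p ≤ n
count≤n {zero} p = z≤n
count≤n {suc n} p with p zero
... | true = s≤s (count≤n (λ i → p (suc i)))
... | false = ≤-trans (count≤n (λ i → p (suc i))) (m≤n+m n 1)

count-mono : (p q : Fin n → Bool) → (∀ i → p i ≡ true → q i ≡ true) → count p ≤ count q
count-mono {zero} p q p⊆q = z≤n
count-mono {suc n} p q p⊆q with p zero in p₀ | q zero in q₀
... | false | _ = ≤-trans (count-mono _ _ (λ i → p⊆q (suc i))) (m≤n+m _ _)
... | true | true = s≤s (count-mono _ _ (λ i → p⊆q (suc i)))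
... | true | false = ⊥-elim (true≢false (p⊆q zero p₀) q₀)

count-none : (p : Fin n → Bool) → (∀ i → p i ≡ false) → count p ≡ 0
count-none {zero} p none = refl
count-none {suc n} p none rewrite none zero = count-none (λ i → p (suc i)) (λ i → none (suc i))

count-all : (p : Fin n → Bool) → (∀ i → p i ≡ true) → count p ≡ n
count-all {zero} p all = refl
count-all {suc n} p all rewrite all zero = cong suc (count-all (λ i → p (suc i)) (λ i → all (suc i)))

count-unique : (p : Fin n → Bool) (c : Fin n) → p c ≡ true → (∀ i → p i ≡ true → i ≡ c) → count p ≡ 1
count-unique p c pc unique = trans (count≡sum p) (trans (sum-cong-≗ indicator≡δ) (sum-δ* c (λ _ → 1)))
  where
  indicator≡δ : ∀ i → indicator (p i) ≡ δ i c * 1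
  indicator≡δ i with i ≟ c
  ... | yes refl = cong indicator pc
  ... | no i≢c with p i in pi
  ...   | true = ⊥-elim (i≢c (unique i pi))
  ...   | false = refl

count-split : (p q : Fin n → Bool) → count p ≡ count (λ i → p i ∧ q i) + count (λ i → p i ∧ not (q i))
count-split {zero} p q = refl
count-split {suc n} p q with p zero | q zero
... | false | _ = count-split (λ i → p (suc i)) (λ i → q (suc i))
... | true | true = cong suc (count-split (λ i → p (suc i)) (λ i → q (suc i)))
... | true | false = trans (cong suc (count-split (λ i → p (suc i)) (λ i → q (suc i)))) (sym (+-suc _ _))

count-∖ : (p q : Fin n → Bool) → (∀ i → q i ≡ true → p i ≡ true) →
  count p ≡ count q + count (λ i → p i ∧ not (q i))
count-∖ p q q⊆p = trans (count-split p q) (cong (_+ count (λ i → p i ∧ not (q i))) (count-cong q∩p≗q))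
  where
  q∩p≗q : ∀ i → p i ∧ q i ≡ q i
  q∩p≗q i with q i in qi
  ... | true rewrite q⊆p i qi = refl
  ... | false = ∧-zeroʳ (p i)

count-∨ : (p q : Fin n → Bool) → (∀ i → p i ≡ true → q i ≡ false) →
  count (λ i → p i ∨ q i) ≡ count p + count q
count-∨ {zero} p q disjoint = refl
count-∨ {suc n} p q disjoint with p zero in p₀ | q zero in q₀
... | true | true = ⊥-elim (true≢false q₀ (disjoint zero p₀))
... | true | false = cong suc (count-∨ _ _ (λ i → disjoint (suc i)))
... | false | true = trans (cong suc (count-∨ _ _ (λ i → disjoint (suc i)))) (sym (+-suc _ _))
... | false | false = count-∨ _ _ (λ i → disjoint (suc i))

∈⇒0<count : (p : Fin n → Bool) (i : Fin n) → p i ≡ true → 0 < count p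
∈⇒0<count p zero pi rewrite pi = s≤s z≤n
∈⇒0<count p (suc i) pi = ≤-trans (∈⇒0<count (λ j → p (suc j)) i pi) (m≤n+m _ _)

0<count⇒∃ : (p : Fin n → Bool) → 0 < count p → ∃ λ i → p i ≡ true
0<count⇒∃ {suc n} p 0<count with p zero in p₀
... | true = zero , p₀
... | false with 0<count⇒∃ (λ i → p (suc i)) 0<count
...   | i , pi = suc i , pi

count≤1⇒unique : (p : Fin n → Bool) → count p ≤ 1 → ∀ i j → p i ≡ true → p j ≡ true → i ≡ j
count≤1⇒unique p count≤1 zero zero pi pj = refl
count≤1⇒unique p count≤1 zero (suc j) pi pj rewrite pi =
  ⊥-elim (<⇒≱ (s≤s (∈⇒0<count (λ k → p (suc k)) j pj)) count≤1)
count≤1⇒unique p count≤1 (suc i) zero pi pj rewrite pj =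
  ⊥-elim (<⇒≱ (s≤s (∈⇒0<count (λ k → p (suc k)) i pi)) count≤1)
count≤1⇒unique p count≤1 (suc i) (suc j) pi pj =
  cong suc (count≤1⇒unique (λ k → p (suc k)) (≤-trans (m≤n+m _ _) count≤1) i j pi pj)

count≡1⇒∃! : (p : Fin n → Bool) → count p ≡ 1 → ∃ λ c → p c ≡ true × ∀ i → p i ≡ true → i ≡ c
count≡1⇒∃! p count≡1 =
  let c , pc = 0<count⇒∃ p (≤-reflexive (sym count≡1))
  in c , pc , λ i pi → count≤1⇒unique p (≤-reflexive count≡1) i c pi pc

count-≟ : (c : Fin n) → count (λ i → ⌊ i ≟ c ⌋) ≡ 1
count-≟ c = count-unique _ c (≡⇒≟-true refl) (λ i → ≟-true⇒≡)

1<count⇒∃≢ : (p : Fin n → Bool) → 1 < count p → (c : Fin n) → ∃ λ i → p i ≡ true × i ≢ c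
1<count⇒∃≢ p 1<count c with 0<count⇒∃ (λ i → p i ∧ not ⌊ i ≟ c ⌋) 0<count-off-c
  where
  count-at-c≤1 : count (λ i → p i ∧ ⌊ i ≟ c ⌋) ≤ 1
  count-at-c≤1 = ≤-trans (count-mono _ _ (λ i → ∧-conicalʳ (p i) _)) (≤-reflexive (count-≟ c))
  0<count-off-c : 0 < count (λ i → p i ∧ not ⌊ i ≟ c ⌋)
  0<count-off-c = s≤s⁻¹ (≤-trans 1<count (≤-trans (≤-reflexive (count-split p (λ i → ⌊ i ≟ c ⌋)))
                    (+-monoˡ-≤ _ count-at-c≤1)))
... | i , e = i , ∧-conicalˡ (p i) _ e , λ i≡c → true≢false (∧-conicalʳ (p i) _ e) (cong not (≡⇒≟-true i≡c))

anyFin⇒∃ : (p : Fin n → Bool) → anyFin p ≡ true → ∃ λ i → p i ≡ true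
anyFin⇒∃ {suc n} p any with p zero in p₀
... | true = zero , p₀
... | false with anyFin⇒∃ (λ i → p (suc i)) any
...   | i , pi = suc i , pi

∃⇒anyFin : (p : Fin n → Bool) (i : Fin n) → p i ≡ true → anyFin p ≡ true
∃⇒anyFin p zero pi rewrite pi = refl
∃⇒anyFin p (suc i) pi with p zero
... | true = refl
... | false = ∃⇒anyFin (λ j → p (suc j)) i pi

indicator-anyFin≤count : (p : Fin n → Bool) → indicator (anyFin p) ≤ count p
indicator-anyFin≤count {zero} p = z≤n
indicator-anyFin≤count {suc n} p with p zero
... | true = s≤s z≤n
... | false = indicator-anyFin≤count (λ i → p (suc i))

indicator-anyFin≡count : (p : Fin n → Bool) → (∀ i j → p i ≡ true → p j ≡ true → i ≡ j) →
  indicator (anyFin p) ≡ count p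
indicator-anyFin≡count p unique with anyFin p in any
... | false = sym (count-none p (λ i → ¬true⇒false (λ pi → true≢false (∃⇒anyFin p i pi) any)))
... | true with anyFin⇒∃ p any
...   | c , pc = sym (count-unique p c pc (λ i pi → unique i c pi pc))

InjectiveOn : (Fin n → Bool) → (Fin n → Fin m) → Set
InjectiveOn p h = ∀ i j → p i ≡ true → p j ≡ true → h i ≡ h j → i ≡ j

count-image : (p : Fin n → Bool) (h : Fin n → Fin m) → InjectiveOn p h →
  count (λ y → anyFin (λ i → p i ∧ ⌊ h i ≟ y ⌋)) ≡ count p
count-image {n} {m} p h injective = begin
  count (λ y → anyFin (λ i → p i ∧ ⌊ h i ≟ y ⌋))
    ≡⟨ count≡sum (λ y → anyFin (λ i → p i ∧ ⌊ h i ≟ y ⌋)) ⟩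
  sum (λ y → indicator (anyFin (λ i → p i ∧ ⌊ h i ≟ y ⌋)))
    ≡⟨ sum-cong-≗ (λ y → indicator-anyFin≡count _ (fibre-unique y)) ⟩
  sum (λ y → count (λ i → p i ∧ ⌊ h i ≟ y ⌋))
    ≡⟨ sum-cong-≗ (λ y → trans (count-∧≡sum-* p (λ i → ⌊ h i ≟ y ⌋))
                               (sum-cong-≗ (λ i → *-comm (indicator (p i)) _))) ⟩
  sum (λ y → sum (λ i → δ (h i) y * indicator (p i)))
    ≡⟨ ∑-comm (λ y i → δ (h i) y * indicator (p i)) ⟩
  sum (λ i → sum (λ y → δ (h i) y * indicator (p i)))
    ≡⟨ sum-cong-≗ (λ i → trans (sum-cong-≗ (λ y → cong (_* indicator (p i)) (δ-sym (h i) y))) (sum-δ* (h i) _)) ⟩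
  sum (λ i → indicator (p i))
    ≡⟨ count≡sum p ⟨
  count p ∎
  where
  open ≡-Reasoning
  fibre-unique : ∀ y i j → p i ∧ ⌊ h i ≟ y ⌋ ≡ true → p j ∧ ⌊ h j ≟ y ⌋ ≡ true → i ≡ j
  fibre-unique y i j ei ej = injective i j (∧-conicalˡ (p i) _ ei) (∧-conicalˡ (p j) _ ej)
    (trans (≟-true⇒≡ (∧-conicalʳ (p i) _ ei)) (sym (≟-true⇒≡ (∧-conicalʳ (p j) _ ej))))

count-point∪image : (adj : Fin m → Bool) (p : Fin n → Bool) (h : Fin n → Fin m) (x : Fin m) →
  (∀ y → adj y ≡ true → x ≡ y ⊎ ∃ λ i → p i ≡ true × h i ≡ y) →
  (∀ y → x ≡ y ⊎ (∃ λ i → p i ≡ true × h i ≡ y) → adj y ≡ true) →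
  (∀ i → p i ≡ true → h i ≢ x) → InjectiveOn p h → count adj ≡ suc (count p)
count-point∪image {m = m} adj p h x adj⇒ ⇒adj avoids-x injective = begin
  count adj                              ≡⟨ count-cong adj≗x∪image ⟩
  count (λ y → ⌊ x ≟ y ⌋ ∨ image y)      ≡⟨ count-∨ (λ y → ⌊ x ≟ y ⌋) image disjoint ⟩
  count (λ y → ⌊ x ≟ y ⌋) + count image  ≡⟨ cong₂ _+_ (count-unique _ x (≡⇒≟-true refl) (λ y e → sym (≟-true⇒≡ e)))
                                                      (count-image p h injective) ⟩
  suc (count p)                          ∎
  where
  open ≡-Reasoning
  image : Fin m → Bool
  image y = anyFin (λ i → p i ∧ ⌊ h i ≟ y ⌋)
  image⇒ : ∀ {y} → image y ≡ true → ∃ λ i → p i ≡ true × h i ≡ y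
  image⇒ {y} e = let i , e′ = anyFin⇒∃ _ e in i , ∧-conicalˡ (p i) _ e′ , ≟-true⇒≡ (∧-conicalʳ (p i) _ e′)
  adj≗x∪image : ∀ y → adj y ≡ ⌊ x ≟ y ⌋ ∨ image y
  adj≗x∪image y = ≡-from-true⇔true to from
    where
    to : adj y ≡ true → ⌊ x ≟ y ⌋ ∨ image y ≡ true
    to e with adj⇒ y e
    ... | inj₁ x≡y rewrite ≡⇒≟-true x≡y = refl
    ... | inj₂ (i , pi , hi≡y) =
      trans (cong (⌊ x ≟ y ⌋ ∨_) (∃⇒anyFin _ i (cong₂ _∧_ pi (≡⇒≟-true hi≡y)))) (∨-zeroʳ _)
    from : ⌊ x ≟ y ⌋ ∨ image y ≡ true → adj y ≡ true
    from e with x ≟ y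
    ... | yes x≡y = ⇒adj y (inj₁ x≡y)
    ... | no _ = ⇒adj y (inj₂ (image⇒ e))
  disjoint : ∀ y → ⌊ x ≟ y ⌋ ≡ true → image y ≡ false
  disjoint y e = ¬true⇒false λ e′ → let i , pi , hi≡y = image⇒ e′ in avoids-x i pi (trans hi≡y (sym (≟-true⇒≡ e)))

count-⋃≤sum-count : (p : Fin m → Bool) (M : Fin m → Fin n → Bool) →
  count (λ j → anyFin (λ i → p i ∧ M i j)) ≤ sum (λ i → indicator (p i) * count (M i))
count-⋃≤sum-count p M = begin
  count (λ j → anyFin (λ i → p i ∧ M i j))
    ≡⟨ count≡sum (λ j → anyFin (λ i → p i ∧ M i j)) ⟩
  sum (λ j → indicator (anyFin (λ i → p i ∧ M i j)))
    ≤⟨ sum-mono-≤ (λ j → indicator-anyFin≤count (λ i → p i ∧ M i j)) ⟩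
  sum (λ j → count (λ i → p i ∧ M i j))
    ≡⟨ sum-cong-≗ (λ j → count-∧≡sum-* p (λ i → M i j)) ⟩
  sum (λ j → sum (λ i → indicator (p i) * indicator (M i j)))
    ≡⟨ ∑-comm (λ j i → indicator (p i) * indicator (M i j)) ⟩
  sum (λ i → sum (λ j → indicator (p i) * indicator (M i j)))
    ≡⟨ sum-cong-≗ (λ i → trans (cong (indicator (p i) *_) (count≡sum (M i)))
                               (*-distribˡ-sum (indicator (p i)) (λ j → indicator (M i j)))) ⟨
  sum (λ i → indicator (p i) * count (M i)) ∎
  where open ≤-Reasoning

-- Injective self-maps of finite sets

injective⇒surjective : (h : Fin n → Fin n) → (∀ x y → h x ≡ h y → x ≡ y) → ∀ t → ∃ λ x → h x ≡ t
injective⇒surjective {suc n} h injective t with any? (λ x → h x ≟ t)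
... | yes hit = hit
... | no miss = ⊥-elim (1+n≰n (injective⇒≤ {f = h-t} h-t-injective))
  where
  h-t : Fin (suc n) → Fin n
  h-t x = punchOut {i = t} {j = h x} (λ t≡hx → miss (x , sym t≡hx))
  h-t-injective : ∀ {x y} → h-t x ≡ h-t y → x ≡ y
  h-t-injective {x} {y} e = injective x y (punchOut-injective (λ t≡hx → miss (x , sym t≡hx)) (λ t≡hy → miss (y , sym t≡hy)) e)

funToFin-cong : ∀ {q} {y y' : Fin n → Fin q} → y ≗ y' → funToFin y ≡ funToFin y'
funToFin-cong {zero} y≗y' = refl
funToFin-cong {suc n} y≗y' = cong₂ combine (y≗y' zero) (funToFin-cong (λ i → y≗y' (suc i)))

vec-injective⇒surjective : ∀ {q} (h : (Fin n → Fin q) → (Fin n → Fin q)) →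
  (∀ y y' → h y ≗ h y' → y ≗ y') → ∀ t → ∃ λ y → h y ≗ t
vec-injective⇒surjective {n} {q} h injective t =
  let k , e = injective⇒surjective H H-injective (funToFin t)
  in finToFun k , λ i → trans (coordinates e i) (finToFun-funToFin t i)
  where
  H : Fin (q ^ n) → Fin (q ^ n)
  H k = funToFin (h (finToFun k))
  coordinates : ∀ {k k'} → funToFin {n} {q} (h (finToFun k)) ≡ k' → h (finToFun k) ≗ finToFun k'
  coordinates {k} e i = trans (sym (finToFun-funToFin (h (finToFun k)) i)) (cong (λ z → finToFun z i) e)
  H-injective : ∀ x y → H x ≡ H y → x ≡ y
  H-injective x y e = begin
    x ≡⟨ funToFin-finToFin {n} {q} x ⟨
    funToFin {n} {q} (finToFun x) ≡⟨ funToFin-cong (injective (finToFun x) (finToFun y) hx≗hy) ⟩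
    funToFin {n} {q} (finToFun y) ≡⟨ funToFin-finToFin {n} {q} y ⟩
    y ∎
    where
    open ≡-Reasoning
    hx≗hy : h (finToFun x) ≗ h (finToFun y)
    hx≗hy i = trans (coordinates e i) (finToFun-funToFin (h (finToFun y)) i)

-- Congruence modulo q

module Congruence (q : ℕ) .{{_ : NonZero q}} where

  -- A record rather than a synonym for x % q ≡ y % q, so that x and y remain inferable.
  infix 4 _≈_
  record _≈_ (x y : ℕ) : Set where
    constructor mod-q
    field %-≡ : x % q ≡ y % q
  open _≈_

  ≈-setoid : Setoid _ _
  ≈-setoid = record
    { Carrier = ℕ ; _≈_ = _≈_
    ; isEquivalence = record
      { refl = mod-q refl
      ; sym = λ x≈y → mod-q (sym (%-≡ x≈y))
      ; trans = λ x≈y y≈z → mod-q (trans (%-≡ x≈y) (%-≡ y≈z)) } }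

  open Setoid ≈-setoid public using () renaming (refl to ≈-refl; sym to ≈-sym; trans to ≈-trans; reflexive to ≡⇒≈)

  +-cong : ∀ {x y z t} → x ≈ y → z ≈ t → x + z ≈ y + t
  +-cong {x} {y} {z} {t} (mod-q x≈y) (mod-q z≈t) = mod-q (begin
    (x + z) % q ≡⟨ %-distribˡ-+ x z q ⟩
    (x % q + z % q) % q ≡⟨ cong₂ (λ u v → (u + v) % q) x≈y z≈t ⟩
    (y % q + t % q) % q ≡⟨ %-distribˡ-+ y t q ⟨
    (y + t) % q ∎)
    where open ≡-Reasoning

  *-cong : ∀ {x y z t} → x ≈ y → z ≈ t → x * z ≈ y * t
  *-cong {x} {y} {z} {t} (mod-q x≈y) (mod-q z≈t) = mod-q (begin
    (x * z) % q ≡⟨ %-distribˡ-* x z q ⟩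
    (x % q * (z % q)) % q ≡⟨ cong₂ (λ u v → (u * v) % q) x≈y z≈t ⟩
    (y % q * (t % q)) % q ≡⟨ %-distribˡ-* y t q ⟨
    (y * t) % q ∎)
    where open ≡-Reasoning

  sum-cong : ∀ {n} {f g : Fin n → ℕ} → (∀ i → f i ≈ g i) → sum f ≈ sum g
  sum-cong {zero} f≈g = ≈-refl
  sum-cong {suc n} f≈g = +-cong (f≈g zero) (sum-cong (λ i → f≈g (suc i)))

  m%q≈m : ∀ x → x % q ≈ x
  m%q≈m x = mod-q (m%n%n≡m%n x q)

  m+q*c≈m : ∀ x c → x + q * c ≈ x
  m+q*c≈m x c = mod-q (%-remove-+ʳ x (m∣m*n c))

  ≈-canonical : ∀ {x y} → x < q → y < q → x ≈ y → x ≡ y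
  ≈-canonical {x} {y} x<q y<q (mod-q x≈y) = trans (sym (m<n⇒m%n≡m x<q)) (trans x≈y (m<n⇒m%n≡m y<q))

sum-[J+I] : ∀ {n} (z : Fin n → ℕ) → sum (λ k → sum z + z k) ≡ suc n * sum z
sum-[J+I] {n} z = trans (∑-distrib-+ (λ _ → sum z) z) (trans (cong (_+ sum z) (sum-const {n} (sum z))) (+-comm (n * sum z) (sum z)))

module _ {n : ℕ} where
  open Congruence (suc (suc n))
  open import Relation.Binary.Reasoning.Setoid ≈-setoid

  J+I-injective-mod : (z z' : Fin n → ℕ) → (∀ k → sum z + z k ≈ sum z' + z' k) → ∀ k → z k ≈ z' k
  J+I-injective-mod z z' [J+I]z≈[J+I]z' k = begin
    z k                                  ≈⟨ m+q*c≈m (z k) (sum z') ⟨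
    z k + suc (suc n) * sum z'           ≡⟨ shift n (sum z') (z k) ⟨
    sum z' + z k + suc n * sum z'        ≈⟨ +-cong (+-cong Σz'≈Σz ≈-refl) ≈-refl ⟩
    sum z + z k + suc n * sum z'         ≈⟨ +-cong ([J+I]z≈[J+I]z' k) ≈-refl ⟩
    sum z' + z' k + suc n * sum z'       ≡⟨ shift n (sum z') (z' k) ⟩
    z' k + suc (suc n) * sum z'          ≈⟨ m+q*c≈m (z' k) (sum z') ⟩
    z' k                                 ∎
    where
    shift : ∀ n Z x → Z + x + suc n * Z ≡ x + suc (suc n) * Z
    shift = solve-∀
    square : ∀ n Z → suc n * (suc n * Z) ≡ Z + suc (suc n) * (n * Z)
    square = solve-∀
    [n+1]Σz≈[n+1]Σz' : suc n * sum z ≈ suc n * sum z'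
    [n+1]Σz≈[n+1]Σz' = begin
      suc n * sum z                  ≡⟨ sum-[J+I] z ⟨
      sum (λ k → sum z + z k)        ≈⟨ sum-cong [J+I]z≈[J+I]z' ⟩
      sum (λ k → sum z' + z' k)      ≡⟨ sum-[J+I] z' ⟩
      suc n * sum z'                 ∎
    Σz'≈Σz : sum z' ≈ sum z
    Σz'≈Σz = begin
      sum z'                                  ≈⟨ m+q*c≈m (sum z') (n * sum z') ⟨
      sum z' + suc (suc n) * (n * sum z')     ≡⟨ square n (sum z') ⟨
      suc n * (suc n * sum z')                ≈⟨ *-cong (≈-refl {suc n}) [n+1]Σz≈[n+1]Σz' ⟨
      suc n * (suc n * sum z)                 ≡⟨ square n (sum z) ⟩
      sum z + suc (suc n) * (n * sum z)       ≈⟨ m+q*c≈m (sum z) (n * sum z) ⟩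
      sum z                                   ∎

-- Lehman matrices with k = 1 satisfy BᵀA = J + I

module LehmanTranspose {n r : ℕ} (A B : BipGraph n) (regular : Regular r A)
                       (A·Bᵀ≡J+I : ∀ i j → mulT A B i j ≡ suc (δ i j)) where

  a b : Fin n → Fin n → ℕ
  a i j = indicator (A i j)
  b i j = indicator (B i j)

  A·Bᵀ : ∀ i j → sum (λ l → a i l * b j l) ≡ suc (δ i j)
  A·Bᵀ i j = trans (sym (count-∧≡sum-* (A i) (B j))) (A·Bᵀ≡J+I i j)

  row-sum : ∀ i → sum (a i) ≡ r
  row-sum i = trans (sym (count≡sum (A i))) (proj₁ regular i)

  column-sum : ∀ j → sum (λ i → a i j) ≡ r
  column-sum j = trans (sym (count≡sum (λ i → A i j))) (proj₂ regular j)

  r*|Bⱼ|≡n+1 : ∀ j → r * count (B j) ≡ suc n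
  r*|Bⱼ|≡n+1 j = begin
    r * count (B j)                              ≡⟨ cong (r *_) (count≡sum (B j)) ⟩
    r * sum (b j)                                ≡⟨ *-distribˡ-sum r (b j) ⟩
    sum (λ l → r * b j l)                        ≡⟨ sum-cong-≗ (λ l → cong (_* b j l) (column-sum l)) ⟨
    sum (λ l → sum (λ i → a i l) * b j l)        ≡⟨ sum-cong-≗ (λ l → *-distribʳ-sum (b j l) (λ i → a i l)) ⟩
    sum (λ l → sum (λ i → a i l * b j l))        ≡⟨ ∑-comm (λ l i → a i l * b j l) ⟩
    sum (λ i → sum (λ l → a i l * b j l))        ≡⟨ sum-cong-≗ (λ i → A·Bᵀ i j) ⟩
    sum (λ i → suc (δ i j))                      ≡⟨ ∑-distrib-+ (λ _ → 1) (λ i → δ i j) ⟩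
    sum {n} (λ _ → 1) + sum (λ i → δ i j)        ≡⟨ cong₂ _+_ (trans (sum-const {n} 1) (*-identityʳ n))
                                                              (trans (sum-cong-≗ (λ i → sym (*-identityʳ (δ i j))))
                                                                     (sum-δ* j (λ _ → 1))) ⟩
    n + 1                                        ≡⟨ +-comm n 1 ⟩
    suc n                                        ∎
    where open ≡-Reasoning

  AᵀB : Fin n → Fin n → ℕ
  AᵀB w k = sum (λ i → a i w * b i k)

  -- Column w of A(BᵀA) = (ABᵀ)A = (J + I)A = rJ + A = A(J + I).
  A·AᵀB≡A·[J+I] : ∀ w j → sum (λ l → a j l * AᵀB w l) ≡ sum (λ l → a j l * suc (δ w l))
  A·AᵀB≡A·[J+I] w j = begin
    sum (λ l → a j l * AᵀB w l)
      ≡⟨ sum-cong-≗ (λ l → *-comm (a j l) (AᵀB w l)) ⟩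
    sum (λ l → AᵀB w l * a j l)
      ≡⟨ vecMat-matVec-assoc (λ i → a i w) b (a j) ⟩
    sum (λ i → a i w * sum (λ l → b i l * a j l))
      ≡⟨ sum-cong-≗ (λ i → cong (a i w *_) (trans (sum-cong-≗ (λ l → *-comm (b i l) (a j l))) (A·Bᵀ j i))) ⟩
    sum (λ i → a i w * suc (δ j i))
      ≡⟨ sum-*-suc (λ i → a i w) (δ j) ⟩
    sum (λ i → a i w) + sum (λ i → δ j i * a i w)
      ≡⟨ cong₂ _+_ (column-sum w) (trans (sum-cong-≗ (λ i → cong (_* a i w) (δ-sym j i))) (sum-δ* j (λ i → a i w))) ⟩
    r + a j w
      ≡⟨ cong₂ _+_ (row-sum j) (sum-δ* w (a j)) ⟨
    sum (a j) + sum (λ l → δ l w * a j l)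
      ≡⟨ cong (sum (a j) +_) (sum-cong-≗ (λ l → cong (_* a j l) (δ-sym l w))) ⟩
    sum (a j) + sum (λ l → δ w l * a j l)
      ≡⟨ sum-*-suc (a j) (δ w) ⟨
    sum (λ l → a j l * suc (δ w l)) ∎
    where open ≡-Reasoning

  q : ℕ
  q = suc (suc n)

  open Congruence q

  y·A : (Fin n → Fin q) → Fin n → ℕ
  y·A y l = sum (λ i → toℕ (y i) * a i l)

  y·A·Bᵀ : ∀ y k → sum (λ l → y·A y l * b k l) ≡ sum (λ i → toℕ (y i)) + toℕ (y k)
  y·A·Bᵀ y k = begin
    sum (λ l → y·A y l * b k l)
      ≡⟨ vecMat-matVec-assoc (λ i → toℕ (y i)) a (b k) ⟩
    sum (λ i → toℕ (y i) * sum (λ l → a i l * b k l))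
      ≡⟨ sum-cong-≗ (λ i → cong (toℕ (y i) *_) (A·Bᵀ i k)) ⟩
    sum (λ i → toℕ (y i) * suc (δ i k))
      ≡⟨ sum-*-suc (λ i → toℕ (y i)) (λ i → δ i k) ⟩
    sum (λ i → toℕ (y i)) + sum (λ i → δ i k * toℕ (y i))
      ≡⟨ cong (sum (λ i → toℕ (y i)) +_) (sum-δ* k (λ i → toℕ (y i))) ⟩
    sum (λ i → toℕ (y i)) + toℕ (y k) ∎
    where open ≡-Reasoning

  y·A-injective : ∀ y y' → (∀ l → y·A y l ≈ y·A y' l) → y ≗ y'
  y·A-injective y y' yA≈y'A k =
    toℕ-injective (≈-canonical (toℕ<n (y k)) (toℕ<n (y' k))
      (J+I-injective-mod (λ i → toℕ (y i)) (λ i → toℕ (y' i)) [J+I]y≈[J+I]y' k))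
    where
    [J+I]y≈[J+I]y' : ∀ k → sum (λ i → toℕ (y i)) + toℕ (y k) ≈ sum (λ i → toℕ (y' i)) + toℕ (y' k)
    [J+I]y≈[J+I]y' k = ≈-trans (≡⇒≈ (sym (y·A·Bᵀ y k)))
      (≈-trans (sum-cong (λ l → *-cong (yA≈y'A l) ≈-refl)) (≡⇒≈ (y·A·Bᵀ y' k)))

  y·A-mod : (Fin n → Fin q) → Fin n → Fin q
  y·A-mod y l = fromℕ< (m%n<n (y·A y l) q)

  y·A-mod≈ : ∀ y l → toℕ (y·A-mod y l) ≈ y·A y l
  y·A-mod≈ y l = ≈-trans (≡⇒≈ (toℕ-fromℕ< (m%n<n (y·A y l) q))) (m%q≈m (y·A y l))

  A-left-invertible-mod : ∀ k → ∃ λ y → ∀ l → y·A y l ≈ δ l k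
  A-left-invertible-mod k =
    let y , yA≗eₖ = vec-injective⇒surjective y·A-mod y·A-mod-injective eₖ
    in y , λ l → ≈-trans (≈-sym (y·A-mod≈ y l)) (≡⇒≈ (trans (cong toℕ (yA≗eₖ l)) (toℕ-eₖ l)))
    where
    eₖ : Fin n → Fin q
    eₖ l = if ⌊ l ≟ k ⌋ then suc zero else zero
    toℕ-eₖ : ∀ l → toℕ (eₖ l) ≡ δ l k
    toℕ-eₖ l with ⌊ l ≟ k ⌋
    ... | true = refl
    ... | false = refl
    y·A-mod-injective : ∀ y y' → y·A-mod y ≗ y·A-mod y' → y ≗ y'
    y·A-mod-injective y y' e = y·A-injective y y' λ l →
      ≈-trans (≈-sym (y·A-mod≈ y l)) (≈-trans (≡⇒≈ (cong toℕ (e l))) (y·A-mod≈ y' l))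

  A-cancellable-mod : ∀ (x x' : Fin n → ℕ) → (∀ j → sum (λ l → a j l * x l) ≡ sum (λ l → a j l * x' l)) →
    ∀ k → x k ≈ x' k
  A-cancellable-mod x x' Ax≡Ax' k =
    ≈-trans (recover x) (≈-trans (≡⇒≈ (sum-cong-≗ (λ i → cong (toℕ (y i) *_) (Ax≡Ax' i)))) (≈-sym (recover x')))
    where
    y = proj₁ (A-left-invertible-mod k)
    recover : ∀ x → x k ≈ sum (λ i → toℕ (y i) * sum (λ l → a i l * x l))
    recover x = ≈-trans (≡⇒≈ (sym (sum-δ* k x)))
      (≈-trans (sum-cong (λ l → *-cong (≈-sym (proj₂ (A-left-invertible-mod k) l)) ≈-refl))
               (≡⇒≈ (vecMat-matVec-assoc (λ i → toℕ (y i)) a x)))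

  Aᵀ·B≡J+I : ∀ w k → count (λ i → A i w ∧ B i k) ≡ suc (δ w k)
  Aᵀ·B≡J+I w k = trans (count-∧≡sum-* (λ i → A i w) (λ i → B i k))
    (≈-canonical AᵀB<q J+I<q (A-cancellable-mod (AᵀB w) (λ l → suc (δ w l)) (A·AᵀB≡A·[J+I] w) k))
    where
    AᵀB<q : AᵀB w k < q
    AᵀB<q = s≤s (≤-trans (≤-reflexive (sym (count-∧≡sum-* (λ i → A i w) (λ i → B i k))))
                         (≤-trans (count≤n _) (n≤1+n n)))
    J+I<q : suc (δ w k) < q
    J+I<q = s≤s (s≤s (δ≤n w k))
      where
      δ≤n : ∀ {n} (i j : Fin n) → δ i j ≤ n
      δ≤n {suc n} i j with ⌊ i ≟ j ⌋
      ... | true = s≤s z≤n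
      ... | false = z≤n

-- The compressed graph

open import Data.Integer using (+_; -[1+_])
open import Data.Integer.Properties using (+-injective)

Lehman₁⇒A·Bᵀ≡J+I : ∀ {n} {A B : BipGraph n} → (∀ i j → + mulT A B i j ≡ JkI (+ 1) i j) →
  ∀ i j → mulT A B i j ≡ suc (δ i j)
Lehman₁⇒A·Bᵀ≡J+I eq i j with i ≟ j | eq i j
... | yes _ | e = +-injective e
... | no _ | e = +-injective e

J-I⇒Lehman₋₁ : ∀ {n} {A B : BipGraph n} → (∀ i → mulT A B i i ≡ 0) → (∀ i j → i ≢ j → mulT A B i j ≡ 1) →
  ∀ i j → + mulT A B i j ≡ JkI -[1+ 0 ] i j
J-I⇒Lehman₋₁ diagonal off-diagonal i j with i ≟ j
... | yes refl = cong +_ (diagonal i)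
... | no i≢j = cong +_ (off-diagonal i j i≢j)

r≥3⇒r≡1+[r-1] : ∀ {r} → r ≥ 3 → r ≡ suc (r ∸ 1)
r≥3⇒r≡1+[r-1] {suc r} _ = refl

r≥3⇒2≤r-1 : ∀ {r} → r ≥ 3 → 2 ≤ r ∸ 1
r≥3⇒2≤r-1 {suc r} (s≤s 2≤r) = 2≤r

[1+k]n≤k[1+n]⇒n≤k : ∀ k n → suc k * n ≤ k * suc n → n ≤ k
[1+k]n≤k[1+n]⇒n≤k k n h = +-cancelʳ-≤ (k * n) n k (≤-trans h (≤-reflexive (*-suc k n)))

module Compression {n r m : ℕ} (A : BipGraph n) (r≥3 : r ≥ 3) (lehman : Lehman r (+ 1) A)
                   (P : K-Partition r A m) where
  open K-Partition P

  B : BipGraph n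
  B = proj₁ (proj₂ lehman)

  open LehmanTranspose A B (proj₁ lehman) (Lehman₁⇒A·Bᵀ≡J+I {A = A} {B} (proj₂ (proj₂ lehman)))
    using (Aᵀ·B≡J+I; r*|Bⱼ|≡n+1)

  unique-outside : (p q : Fin n → Bool) → (∀ i → q i ≡ true → p i ≡ true) → count p ≡ r → count q ≡ r ∸ 1 →
    count (λ i → p i ∧ not (q i)) ≡ 1
  unique-outside p q q⊆p |p|≡r |q|≡r-1 = +-cancelˡ-≡ (r ∸ 1) _ 1 (begin
    r ∸ 1 + count (λ i → p i ∧ not (q i))   ≡⟨ cong (_+ count (λ i → p i ∧ not (q i))) |q|≡r-1 ⟨
    count q + count (λ i → p i ∧ not (q i)) ≡⟨ count-∖ p q q⊆p ⟨
    count p                                 ≡⟨ trans |p|≡r (r≥3⇒r≡1+[r-1] r≥3) ⟩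
    suc (r ∸ 1)                             ≡⟨ +-comm 1 (r ∸ 1) ⟩
    r ∸ 1 + 1                               ∎)
    where open ≡-Reasoning

  outside-black : Fin n → Fin n → Bool
  outside-black b w = A b w ∧ not ⌊ blkW w ≟ blkB b ⌋

  outside-white : Fin n → Fin n → Bool
  outside-white w b = A b w ∧ not ⌊ blkB b ≟ blkW w ⌋

  outside-of-black : ∀ b → count (outside-black b) ≡ 1
  outside-of-black b = unique-outside (A b) (λ w → ⌊ blkW w ≟ blkB b ⌋)
    (λ w e → complete b w (sym (≟-true⇒≡ e))) (proj₁ (proj₁ lehman) b) (sizeW (blkB b))

  outside-of-white : ∀ w → count (outside-white w) ≡ 1
  outside-of-white w = unique-outside (λ b → A b w) (λ b → ⌊ blkB b ≟ blkW w ⌋)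
    (λ b e → complete b w (≟-true⇒≡ e)) (proj₂ (proj₁ lehman) w) (sizeB (blkW w))

  f-spec : ∀ b → ∃ λ w → outside-black b w ≡ true × ∀ w′ → outside-black b w′ ≡ true → w′ ≡ w
  f-spec b = count≡1⇒∃! (outside-black b) (outside-of-black b)

  f : Fin n → Fin n
  f b = proj₁ (f-spec b)

  f-adjacent : ∀ b → A b (f b) ≡ true
  f-adjacent b = proj₁ (∧-≢-true⇒ (proj₁ (proj₂ (f-spec b))))

  f-outside : ∀ b → blkW (f b) ≢ blkB b
  f-outside b = proj₂ (∧-≢-true⇒ (proj₁ (proj₂ (f-spec b))))

  f-unique : ∀ b w → A b w ≡ true → blkW w ≢ blkB b → w ≡ f b
  f-unique b w e w∉X = proj₂ (proj₂ (f-spec b)) w (⇒∧-≢-true e w∉X)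

  g-spec : ∀ w → ∃ λ b → outside-white w b ≡ true × ∀ b′ → outside-white w b′ ≡ true → b′ ≡ b
  g-spec w = count≡1⇒∃! (outside-white w) (outside-of-white w)

  g : Fin n → Fin n
  g w = proj₁ (g-spec w)

  g-adjacent : ∀ w → A (g w) w ≡ true
  g-adjacent w = proj₁ (∧-≢-true⇒ (proj₁ (proj₂ (g-spec w))))

  g-outside : ∀ w → blkB (g w) ≢ blkW w
  g-outside w = proj₂ (∧-≢-true⇒ (proj₁ (proj₂ (g-spec w))))

  g-unique : ∀ w b → A b w ≡ true → blkB b ≢ blkW w → b ≡ g w
  g-unique w b e b∉Y = proj₂ (proj₂ (g-spec w)) b (⇒∧-≢-true e b∉Y)

  g∘f≡id : ∀ b → g (f b) ≡ b
  g∘f≡id b = sym (g-unique (f b) b (f-adjacent b) (λ e → f-outside b (sym e)))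

  f∘g≡id : ∀ w → f (g w) ≡ w
  f∘g≡id w = sym (f-unique (g w) w (g-adjacent w) (λ e → g-outside w (sym e)))

  neighbours-of-black : ∀ {b w} → A b w ≡ true → blkW w ≡ blkB b ⊎ w ≡ f b
  neighbours-of-black {b} {w} e with blkW w ≟ blkB b
  ... | yes same = inj₁ same
  ... | no other = inj₂ (f-unique b w e other)

  neighbours-of-white : ∀ {b w} → A b w ≡ true → blkB b ≡ blkW w ⊎ b ≡ g w
  neighbours-of-white {b} {w} e with blkB b ≟ blkW w
  ... | yes same = inj₁ same
  ... | no other = inj₂ (g-unique w b e other)

  A′ : BipGraph m
  A′ = compress P

  compress-adjacent⇒ : ∀ X Y → A′ X Y ≡ true → X ≡ Y ⊎ ∃ λ b → blkB b ≡ X × blkW (f b) ≡ Y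
  compress-adjacent⇒ X Y e with X ≟ Y
  ... | yes X≡Y = inj₁ X≡Y
  ... | no X≢Y =
    let b , e₁ = anyFin⇒∃ _ e
        w , e₂ = anyFin⇒∃ _ e₁
        b∈X = ≟-true⇒≡ (∧-conicalˡ _ _ e₂)
        w∈Y = ≟-true⇒≡ (∧-conicalˡ _ _ (∧-conicalʳ ⌊ blkB b ≟ X ⌋ _ e₂))
        b~w = ∧-conicalʳ ⌊ blkW w ≟ Y ⌋ _ (∧-conicalʳ ⌊ blkB b ≟ X ⌋ _ e₂)
    in case neighbours-of-black b~w of λ where
         (inj₁ same) → ⊥-elim (X≢Y (trans (sym b∈X) (trans (sym same) w∈Y)))
         (inj₂ w≡fb) → inj₂ (b , b∈X , trans (cong blkW (sym w≡fb)) w∈Y)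

  compress-refl : ∀ X → A′ X X ≡ true
  compress-refl X rewrite ≟-refl X = refl

  compress-outside : ∀ b → A′ (blkB b) (blkW (f b)) ≡ true
  compress-outside b with blkB b ≟ blkW (f b)
  ... | yes _ = refl
  ... | no _ = ∃⇒anyFin _ b (∃⇒anyFin _ (f b)
                 (cong₂ _∧_ (≟-refl (blkB b)) (cong₂ _∧_ (≟-refl (blkW (f b))) (f-adjacent b))))

  1<|black-block| : ∀ X → 1 < count (λ b → ⌊ blkB b ≟ X ⌋)
  1<|black-block| X = subst (1 <_) (sym (sizeB X)) (r≥3⇒2≤r-1 r≥3)

  1<|white-block| : ∀ Y → 1 < count (λ w → ⌊ blkW w ≟ Y ⌋)
  1<|white-block| Y = subst (1 <_) (sym (sizeW Y)) (r≥3⇒2≤r-1 r≥3)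

  black-in-block : ∀ X → ∃ λ b → blkB b ≡ X
  black-in-block X = case 0<count⇒∃ _ (≤-trans (n≤1+n 1) (1<|black-block| X)) of λ where
    (b , b∈X) → b , ≟-true⇒≡ b∈X

  white-in-block : ∀ Y → ∃ λ w → blkW w ≡ Y
  white-in-block Y = case 0<count⇒∃ _ (≤-trans (n≤1+n 1) (1<|white-block| Y)) of λ where
    (w , w∈Y) → w , ≟-true⇒≡ w∈Y

  white-in-block-≢ : ∀ Y u → ∃ λ w → blkW w ≡ Y × w ≢ u
  white-in-block-≢ Y u = case 1<count⇒∃≢ _ (1<|white-block| Y) u of λ where
    (w , w∈Y , w≢u) → w , ≟-true⇒≡ w∈Y , w≢u

  module Column (w′ : Fin n) where
    C : Fin n → Bool
    C i = B i w′

    meets-neighbourhood-once : ∀ {w i j} → w ≢ w′ → A i w ≡ true → A j w ≡ true → C i ≡ true → C j ≡ true → i ≡ j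
    meets-neighbourhood-once {w} {i} {j} w≢w′ i~w j~w Ci Cj =
      count≤1⇒unique (λ k → A k w ∧ C k) (≤-reflexive (trans (Aᵀ·B≡J+I w w′) (cong suc (δ-≢ w≢w′))))
        i j (cong₂ _∧_ i~w Ci) (cong₂ _∧_ j~w Cj)

    meets-block-once : ∀ {X b₁ b₂} → blkB b₁ ≡ X → blkB b₂ ≡ X → C b₁ ≡ true → C b₂ ≡ true → b₁ ≡ b₂
    meets-block-once {X} {b₁} {b₂} b₁∈X b₂∈X Cb₁ Cb₂ =
      let w , w∈X , w≢w′ = white-in-block-≢ X w′
      in meets-neighbourhood-once w≢w′ (complete b₁ w (trans b₁∈X (sym w∈X))) (complete b₂ w (trans b₂∈X (sym w∈X)))
           Cb₁ Cb₂

    misses-block⇒contains-g : ∀ w → (∀ b → blkB b ≡ blkW w → C b ≡ false) → C (g w) ≡ true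
    misses-block⇒contains-g w misses =
      let i , e = 0<count⇒∃ (λ k → A k w ∧ C k) (subst (0 <_) (sym (Aᵀ·B≡J+I w w′)) (s≤s z≤n))
          Ci = ∧-conicalʳ (A i w) _ e
      in case neighbours-of-white (∧-conicalˡ (A i w) _ e) of λ where
           (inj₁ i∈Y) → ⊥-elim (true≢false Ci (misses i i∈Y))
           (inj₂ i≡gw) → subst (λ k → C k ≡ true) i≡gw Ci

    meets-block⇒omits-g : ∀ {w b} → w ≢ w′ → blkB b ≡ blkW w → C b ≡ true → C (g w) ≡ false
    meets-block⇒omits-g {w} {b} w≢w′ b∈Y Cb = ¬true⇒false λ Cgw →
      g-outside w (subst (λ k → blkB k ≡ blkW w) (meets-neighbourhood-once w≢w′ (complete b w b∈Y) (g-adjacent w) Cb Cgw) b∈Y)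

    1<|N[w′]∩C| : 1 < count (λ k → A k w′ ∧ C k)
    1<|N[w′]∩C| = ≤-reflexive (sym (trans (Aᵀ·B≡J+I w′ w′) (cong suc (δ-refl w′))))

    meets-own-block : ∃ λ b → blkB b ≡ blkW w′ × C b ≡ true
    meets-own-block = case 1<count⇒∃≢ (λ k → A k w′ ∧ C k) 1<|N[w′]∩C| (g w′) of λ where
      (i , e , i≢g) → case neighbours-of-white {i} {w′} (∧-conicalˡ (A i w′) (C i) e) of λ where
        (inj₁ i∈Y) → i , i∈Y , ∧-conicalʳ (A i w′) (C i) e
        (inj₂ i≡g) → ⊥-elim (i≢g i≡g)

    contains-g : C (g w′) ≡ true
    contains-g = case meets-own-block of λ where
      (b , b∈Y , Cb) → case 1<count⇒∃≢ (λ k → A k w′ ∧ C k) 1<|N[w′]∩C| b of λ where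
        (j , e , j≢b) → case neighbours-of-white {j} {w′} (∧-conicalˡ (A j w′) (C j) e) of λ where
          (inj₁ j∈Y) → ⊥-elim (j≢b (meets-block-once j∈Y b∈Y (∧-conicalʳ (A j w′) (C j) e) Cb))
          (inj₂ j≡g) → subst (λ k → C k ≡ true) j≡g (∧-conicalʳ (A j w′) (C j) e)

  rows-of-block-miss-a-column : ∀ Y → ¬ (∀ w′ → anyFin (λ b → ⌊ blkB b ≟ Y ⌋ ∧ B b w′) ≡ true)
  rows-of-block-miss-a-column Y all-hit = 1+n≰n (≤-trans r≤n (n≤r-1))
    where
    open ≤-Reasoning
    inY : Fin n → ℕ
    inY b = indicator ⌊ blkB b ≟ Y ⌋
    r*∑|Bᵦ|≡[r-1][n+1] : r * sum (λ b → inY b * count (B b)) ≡ (r ∸ 1) * suc n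
    r*∑|Bᵦ|≡[r-1][n+1] = begin-equality
      r * sum (λ b → inY b * count (B b))      ≡⟨ *-distribˡ-sum r (λ b → inY b * count (B b)) ⟩
      sum (λ b → r * (inY b * count (B b)))    ≡⟨ sum-cong-≗ (λ b → x∙yz≈y∙xz r (inY b) (count (B b))) ⟩
      sum (λ b → inY b * (r * count (B b)))    ≡⟨ sum-cong-≗ (λ b → cong (inY b *_) (r*|Bⱼ|≡n+1 b)) ⟩
      sum (λ b → inY b * suc n)                ≡⟨ *-distribʳ-sum (suc n) inY ⟨
      sum inY * suc n                          ≡⟨ cong (_* suc n) (trans (sym (count≡sum (λ b → ⌊ blkB b ≟ Y ⌋))) (sizeB Y)) ⟩
      (r ∸ 1) * suc n                          ∎
    n≤r-1 : n ≤ r ∸ 1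
    n≤r-1 = [1+k]n≤k[1+n]⇒n≤k (r ∸ 1) n (begin
      suc (r ∸ 1) * n                              ≡⟨ cong (_* n) (r≥3⇒r≡1+[r-1] r≥3) ⟨
      r * n                                        ≡⟨ cong (r *_) (count-all _ all-hit) ⟨
      r * count (λ w′ → anyFin (λ b → ⌊ blkB b ≟ Y ⌋ ∧ B b w′))
                                                   ≤⟨ *-monoʳ-≤ r (count-⋃≤sum-count (λ b → ⌊ blkB b ≟ Y ⌋) B) ⟩
      r * sum (λ b → inY b * count (B b))          ≡⟨ r*∑|Bᵦ|≡[r-1][n+1] ⟩
      (r ∸ 1) * suc n                              ∎)
    r≤n : suc (r ∸ 1) ≤ n
    r≤n = case white-in-block Y of λ where
      (w , _) → subst (_≤ n) (trans (proj₂ (proj₁ lehman) w) (r≥3⇒r≡1+[r-1] r≥3)) (count≤n (λ b → A b w))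

  column-missing-block : ∀ Y → ∃ λ w′ → ∀ b → blkB b ≡ Y → B b w′ ≡ false
  column-missing-block Y with any? (λ w′ → anyFin (λ b → ⌊ blkB b ≟ Y ⌋ ∧ B b w′) ≟ᵇ false)
  ... | yes (w′ , missed) = w′ , λ b b∈Y → ¬true⇒false λ Bbw′ →
          true≢false (∃⇒anyFin _ b (cong₂ _∧_ (≡⇒≟-true b∈Y) Bbw′)) missed
  ... | no ¬missed = ⊥-elim (rows-of-block-miss-a-column Y λ w′ → ¬false⇒true (λ missed → ¬missed (w′ , missed)))

  g-injective-on-block : ∀ {w₁ w₂} → blkW w₁ ≡ blkW w₂ → blkB (g w₁) ≡ blkB (g w₂) → w₁ ≡ w₂
  g-injective-on-block {w₁} {w₂} same-Y same-X = begin
    w₁          ≡⟨ f∘g≡id w₁ ⟨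
    f (g w₁)    ≡⟨ cong f (meets-block-once refl (sym same-X) (misses-block⇒contains-g w₁ misses)
                     (misses-block⇒contains-g w₂ (λ b e → misses b (trans e (sym same-Y))))) ⟩
    f (g w₂)    ≡⟨ f∘g≡id w₂ ⟩
    w₂          ∎
    where
    open ≡-Reasoning
    misses : ∀ b → blkB b ≡ blkW w₁ → B b (proj₁ (column-missing-block (blkW w₁))) ≡ false
    misses = proj₂ (column-missing-block (blkW w₁))
    open Column (proj₁ (column-missing-block (blkW w₁)))

  f-injective-on-block : ∀ {b₁ b₂} → blkB b₁ ≡ blkB b₂ → blkW (f b₁) ≡ blkW (f b₂) → b₁ ≡ b₂
  f-injective-on-block {b₁} {b₂} same-X same-Y = begin
    b₁          ≡⟨ g∘f≡id b₁ ⟨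
    g (f b₁)    ≡⟨ cong g (g-injective-on-block same-Y
                     (trans (cong blkB (g∘f≡id b₁)) (trans same-X (cong blkB (sym (g∘f≡id b₂)))))) ⟩
    g (f b₂)    ≡⟨ g∘f≡id b₂ ⟩
    b₂          ∎
    where open ≡-Reasoning

  r-1+1≡r : suc (r ∸ 1) ≡ r
  r-1+1≡r = sym (r≥3⇒r≡1+[r-1] r≥3)

  compress-row-degree : ∀ X → count (A′ X) ≡ r
  compress-row-degree X = trans (count-point∪image (A′ X) (λ b → ⌊ blkB b ≟ X ⌋) (λ b → blkW (f b)) X adjacent⇒ ⇒adjacent
                                  outside injective)
                                (trans (cong suc (sizeB X)) r-1+1≡r)
    where
    adjacent⇒ : ∀ Y → A′ X Y ≡ true → X ≡ Y ⊎ ∃ λ b → ⌊ blkB b ≟ X ⌋ ≡ true × blkW (f b) ≡ Y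
    adjacent⇒ Y e with compress-adjacent⇒ X Y e
    ... | inj₁ X≡Y = inj₁ X≡Y
    ... | inj₂ (b , b∈X , fb∈Y) = inj₂ (b , ≡⇒≟-true b∈X , fb∈Y)
    ⇒adjacent : ∀ Y → X ≡ Y ⊎ (∃ λ b → ⌊ blkB b ≟ X ⌋ ≡ true × blkW (f b) ≡ Y) → A′ X Y ≡ true
    ⇒adjacent Y (inj₁ refl) = compress-refl X
    ⇒adjacent Y (inj₂ (b , b∈X , refl)) = subst (λ Z → A′ Z (blkW (f b)) ≡ true) (≟-true⇒≡ b∈X) (compress-outside b)
    outside : ∀ b → ⌊ blkB b ≟ X ⌋ ≡ true → blkW (f b) ≢ X
    outside b b∈X = subst (blkW (f b) ≢_) (≟-true⇒≡ b∈X) (f-outside b)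
    injective : InjectiveOn (λ b → ⌊ blkB b ≟ X ⌋) (λ b → blkW (f b))
    injective b₁ b₂ b₁∈X b₂∈X = f-injective-on-block (trans (≟-true⇒≡ b₁∈X) (sym (≟-true⇒≡ b₂∈X)))

  compress-column-degree : ∀ Y → count (λ X → A′ X Y) ≡ r
  compress-column-degree Y = trans (count-point∪image (λ X → A′ X Y) (λ w → ⌊ blkW w ≟ Y ⌋) (λ w → blkB (g w)) Y
                                     adjacent⇒ ⇒adjacent outside injective)
                                   (trans (cong suc (sizeW Y)) r-1+1≡r)
    where
    adjacent⇒ : ∀ X → A′ X Y ≡ true → Y ≡ X ⊎ ∃ λ w → ⌊ blkW w ≟ Y ⌋ ≡ true × blkB (g w) ≡ X
    adjacent⇒ X e with compress-adjacent⇒ X Y e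
    ... | inj₁ X≡Y = inj₁ (sym X≡Y)
    ... | inj₂ (b , b∈X , fb∈Y) = inj₂ (f b , ≡⇒≟-true fb∈Y , trans (cong blkB (g∘f≡id b)) b∈X)
    ⇒adjacent : ∀ X → Y ≡ X ⊎ (∃ λ w → ⌊ blkW w ≟ Y ⌋ ≡ true × blkB (g w) ≡ X) → A′ X Y ≡ true
    ⇒adjacent X (inj₁ refl) = compress-refl Y
    ⇒adjacent X (inj₂ (w , w∈Y , refl)) =
      subst (λ Z → A′ (blkB (g w)) Z ≡ true) (trans (cong blkW (f∘g≡id w)) (≟-true⇒≡ w∈Y)) (compress-outside (g w))
    outside : ∀ w → ⌊ blkW w ≟ Y ⌋ ≡ true → blkB (g w) ≢ Y
    outside w w∈Y = subst (blkB (g w) ≢_) (≟-true⇒≡ w∈Y) (g-outside w)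
    injective : InjectiveOn (λ w → ⌊ blkW w ≟ Y ⌋) (λ w → blkB (g w))
    injective w₁ w₂ w₁∈Y w₂∈Y = g-injective-on-block (trans (≟-true⇒≡ w₁∈Y) (sym (≟-true⇒≡ w₂∈Y)))

  module Row (Z : Fin m) where
    b₀ : Fin n
    b₀ = proj₁ (black-in-block Z)

    b₀∈Z : blkB b₀ ≡ Z
    b₀∈Z = proj₂ (black-in-block Z)

    open Column (f b₀)

    meets : Fin m → Bool
    meets V = anyFin (λ b → ⌊ blkB b ≟ V ⌋ ∧ C b)

    row : Fin m → Bool
    row V = not (meets V)

    ⇒meets : ∀ {V} b → blkB b ≡ V → C b ≡ true → meets V ≡ true
    ⇒meets b b∈V Cb = ∃⇒anyFin _ b (cong₂ _∧_ (≡⇒≟-true b∈V) Cb)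

    missed⇒ : ∀ {V} → row V ≡ true → ∀ b → blkB b ≡ V → C b ≡ false
    missed⇒ missed b b∈V = ¬true⇒false λ Cb → true≢false (⇒meets b b∈V Cb) (not-true⇒false missed)

    meets⇒ : ∀ {V} → meets V ≡ true → ∃ λ b → blkB b ≡ V × C b ≡ true
    meets⇒ {V} e = case anyFin⇒∃ (λ b → ⌊ blkB b ≟ V ⌋ ∧ C b) e of λ where
      (b , e′) → b , ≟-true⇒≡ (∧-conicalˡ ⌊ blkB b ≟ V ⌋ (C b) e′) , ∧-conicalʳ ⌊ blkB b ≟ V ⌋ (C b) e′

    C-b₀ : C b₀ ≡ true
    C-b₀ = subst (λ k → C k ≡ true) (g∘f≡id b₀) contains-g

    outside-missed⇒C : ∀ {Y} b → blkW (f b) ≡ Y → row Y ≡ true → C b ≡ true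
    outside-missed⇒C b refl missed = subst (λ k → C k ≡ true) (g∘f≡id b) (misses-block⇒contains-g (f b) (missed⇒ missed))

    diagonal : count (λ Y → A′ Z Y ∧ row Y) ≡ 0
    diagonal = count-none _ λ Y → ¬true⇒false λ e →
      let missed = ∧-conicalʳ (A′ Z Y) (row Y) e in
      case compress-adjacent⇒ Z Y (∧-conicalˡ (A′ Z Y) (row Y) e) of λ where
        (inj₁ refl) → true≢false (⇒meets b₀ b₀∈Z C-b₀) (not-true⇒false missed)
        (inj₂ (b , b∈Z , fb∈Y)) →
          let b≡b₀ = meets-block-once b∈Z b₀∈Z (outside-missed⇒C b fb∈Y missed) C-b₀
              b′ , b′∈Y₀ , Cb′ = meets-own-block
          in true≢false (⇒meets b′ (trans b′∈Y₀ (trans (cong (λ k → blkW (f k)) (sym b≡b₀)) fb∈Y)) Cb′)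
                        (not-true⇒false missed)

    off-diagonal-missed : ∀ X → meets X ≡ false → count (λ Y → A′ X Y ∧ row Y) ≡ 1
    off-diagonal-missed X X-missed = count-unique _ X (cong₂ _∧_ (compress-refl X) (cong not X-missed)) unique
      where
      unique : ∀ Y → A′ X Y ∧ row Y ≡ true → Y ≡ X
      unique Y e = case compress-adjacent⇒ X Y (∧-conicalˡ (A′ X Y) (row Y) e) of λ where
        (inj₁ X≡Y) → sym X≡Y
        (inj₂ (b , b∈X , fb∈Y)) → ⊥-elim (true≢false
          (⇒meets b b∈X (outside-missed⇒C b fb∈Y (∧-conicalʳ (A′ X Y) (row Y) e)))
          X-missed)

    off-diagonal-met : ∀ X b₁ → X ≢ Z → blkB b₁ ≡ X → C b₁ ≡ true → count (λ Y → A′ X Y ∧ row Y) ≡ 1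
    off-diagonal-met X b₁ X≢Z b₁∈X Cb₁ = count-unique _ (blkW (f b₁)) (cong₂ _∧_ adjacent missed) unique
      where
      fb₁≢fb₀ : f b₁ ≢ f b₀
      fb₁≢fb₀ e = X≢Z (trans (sym b₁∈X)
                    (trans (cong blkB (trans (sym (g∘f≡id b₁)) (trans (cong g e) (g∘f≡id b₀)))) b₀∈Z))
      adjacent : A′ X (blkW (f b₁)) ≡ true
      adjacent = subst (λ V → A′ V (blkW (f b₁)) ≡ true) b₁∈X (compress-outside b₁)
      missed : row (blkW (f b₁)) ≡ true
      missed = cong not (¬true⇒false λ e → case meets⇒ e of λ where
        (b , b∈Y , Cb) → true≢false (subst (λ k → C k ≡ true) (sym (g∘f≡id b₁)) Cb₁)
                                    (meets-block⇒omits-g fb₁≢fb₀ b∈Y Cb))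
      unique : ∀ Y → A′ X Y ∧ row Y ≡ true → Y ≡ blkW (f b₁)
      unique Y e = case compress-adjacent⇒ X Y (∧-conicalˡ (A′ X Y) (row Y) e) of λ where
        (inj₁ refl) → ⊥-elim (true≢false (⇒meets b₁ b₁∈X Cb₁) (not-true⇒false (∧-conicalʳ (A′ X Y) (row Y) e)))
        (inj₂ (b , b∈X , fb∈Y)) → trans (sym fb∈Y) (cong (λ k → blkW (f k)) (meets-block-once b∈X b₁∈X
          (outside-missed⇒C b fb∈Y (∧-conicalʳ (A′ X Y) (row Y) e)) Cb₁))

    off-diagonal : ∀ X → X ≢ Z → count (λ Y → A′ X Y ∧ row Y) ≡ 1
    off-diagonal X X≢Z with meets X in e
    ... | false = off-diagonal-missed X e
    ... | true = case meets⇒ e of λ where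
      (b₁ , b₁∈X , Cb₁) → off-diagonal-met X b₁ X≢Z b₁∈X Cb₁

  B′ : BipGraph m
  B′ Z = Row.row Z

  compress-lehman : Lehman r -[1+ 0 ] A′
  compress-lehman = (compress-row-degree , compress-column-degree) , B′ ,
    J-I⇒Lehman₋₁ {A = A′} {B′} Row.diagonal (λ X Z X≢Z → Row.off-diagonal Z X X≢Z)

lemma4p4 : (n r m : ℕ) (A : BipGraph n) → r ≥ 3 → Lehman r (+ 1) A →
    (P : K-Partition r A m) → Lehman r (-[1+ 0 ]) (compress P)
lemma4p4 n r m A r≥3 lehman P = Compression.compress-lehman A r≥3 lehman P
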